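{- Let $q=2^r$. Let $D=DC^-(n,q)$ with $n$ odd, or $D=DC^+(n,q)$ with $n$ even, let $N=|D|$, and let $\{C_j\}_{j=0}^N$ be the weight distribution of the binary code $C(D)$. Then $C_j=C_{N-j}$ for all $j$ with $0\le j\le N$.
   Context: $q=2^r$; $\mathrm{Tr}$ is the matrix trace. $Sp(2n,q)=\{w\in GL(2n,\mathbb{F}_q):{}^twJw=J\}$, $J=\begin{pmatrix}0&1_n\\1_n&0\end{pmatrix}$. $P=P(2n,q)$ is the subgroup of all $\begin{pmatrix}A&0\\0&{}^tA^{ -1}\end{pmatrix}\begin{pmatrix}1_n&B\\0&1_n\end{pmatrix}$, $A\in GL(n,\mathbb{F}_q)$, $B$ symmetric. $\sigma_s=\begin{pmatrix}0&0&1_s&0\\0&1_{n-s}&0&0\\1_s&0&0&0\\0&0&0&1_{n-s}\end{pmatrix}$ (block sizes $s,n-s,s,n-s$). $DC^-(n,q)=P\sigma_{n-1}P$ ($n$ odd), $DC^+(n,q)=P\sigma_{n-2}P$ ($n$ even). Fix an ordering $g_1,\dots,g_N$ of $D$ and let $C(D)=\{u\in\mathbb{F}_2^N:\sum_j u_j\,\mathrm{Tr}\,g_j=0\text{ in }\mathbb{F}_q\}$; $C_j$ is its number of codewords of Hamming weight $j$. -}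

module Defs where

open import Level using (0ℓ)
open import Data.Nat using (ℕ; zero; suc)
import Data.Nat as ℕ
open import Data.Nat.Properties using (_<?_)
open import Data.Fin using (Fin; toℕ; splitAt)
open import Data.Sum using (_⊎_; inj₁; inj₂)
open import Data.Product using (Σ; ∃; ∃-syntax; _×_; _,_)
open import Data.Bool using (Bool; true; false; if_then_else_; _∧_)
open import Data.List using (List; []; _∷_; length; filter; map; _++_)
open import Data.Vec using (Vec; []; _∷_)
open import Data.List.Membership.Propositional using (_∈_)
open import Data.List.Relation.Unary.Any using (Any)
open import Data.List.Relation.Unary.Unique.Propositional using (Unique)
open import Data.List.Relation.Unary.AllPairs using (AllPairs)
open import Algebra.Structures using (IsCommutativeRing)
open import Relation.Binary.PropositionalEquality using (_≡_; _≢_)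
open import Relation.Nullary using (Dec; does; yes; no; ¬_)
open import Relation.Binary using (DecidableEquality)
import Data.Fin as F

record FiniteField : Set₁ where
  infixl 6 _+_
  infixl 7 _*_
  field
    Carrier  : Set
    _+_ _*_  : Carrier → Carrier → Carrier
    -_       : Carrier → Carrier
    0# 1#    : Carrier
    isCommutativeRing : IsCommutativeRing _≡_ _+_ _*_ -_ 0# 1#
    0≢1      : 0# ≢ 1#
    inverse  : ∀ x → x ≢ 0# → ∃[ y ] (x * y ≡ 1#)
    _≟_      : DecidableEquality Carrier
    elements : List Carrier
    complete : ∀ x → x ∈ elements
    unique   : Unique elements

  order : ℕ
  order = length elements

module Matrices (𝔽 : FiniteField) where
  open FiniteField 𝔽

  Mat : ℕ → ℕ → Set
  Mat m k = Fin m → Fin k → Carrier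

  ∑ : ∀ k → (Fin k → Carrier) → Carrier
  ∑ zero    f = 0#
  ∑ (suc k) f = f F.zero + ∑ k (λ i → f (F.suc i))

  _⊗_ : ∀ {m k l} → Mat m k → Mat k l → Mat m l
  _⊗_ {k = k} X Y i j = ∑ k (λ t → X i t * Y t j)

  _≈_ : ∀ {m k} → Mat m k → Mat m k → Set
  X ≈ Y = ∀ i j → X i j ≡ Y i j

  δ : ∀ {m} → Fin m → Fin m → Carrier
  δ i j with does (i F.≟ j)
  ... | true  = 1#
  ... | false = 0#

  𝟙 : ∀ {m} → Mat m m
  𝟙 = δ

  𝟘 : ∀ {m k} → Mat m k
  𝟘 _ _ = 0#

  transpose : ∀ {m k} → Mat m k → Mat k m
  transpose X i j = X j i

  tr : ∀ {m} → Mat m m → Carrier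
  tr {m} X = ∑ m (λ i → X i i)

  block : ∀ {n} → Mat n n → Mat n n → Mat n n → Mat n n → Mat (n ℕ.+ n) (n ℕ.+ n)
  block {n} X Y Z W i j with splitAt n i | splitAt n j
  ... | inj₁ a | inj₁ b = X a b
  ... | inj₁ a | inj₂ b = Y a b
  ... | inj₂ a | inj₁ b = Z a b
  ... | inj₂ a | inj₂ b = W a b

  Symmetric : ∀ {n} → Mat n n → Set
  Symmetric B = transpose B ≈ B

  -- g ∈ P(2n,q): g = diag(A, ᵗA⁻¹) · (1 B ; 0 1), A invertible (A' = A⁻¹), B symmetric
  InP : ∀ n → Mat (n ℕ.+ n) (n ℕ.+ n) → Set
  InP n g = Σ (Mat n n) λ A → Σ (Mat n n) λ A' → Σ (Mat n n) λ B →
              ((A ⊗ A') ≈ 𝟙) × ((A' ⊗ A) ≈ 𝟙) × Symmetric B ×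
              (g ≈ (block {n} A 𝟘 𝟘 (transpose A') ⊗ block {n} 𝟙 B 𝟘 𝟙))

  -- σ_s with block sizes s, n-s, s, n-s
  σ : ∀ n → ℕ → Mat (n ℕ.+ n) (n ℕ.+ n)
  σ n s = block {n} (λ a b → if does (toℕ a <? s) then 0# else δ a b)
                (λ a b → if does (toℕ a <? s) then δ a b else 0#)
                (λ a b → if does (toℕ a <? s) then δ a b else 0#)
                (λ a b → if does (toℕ a <? s) then 0# else δ a b)

  InDC : ∀ n → ℕ → Mat (n ℕ.+ n) (n ℕ.+ n) → Set
  InDC n s g = Σ (Mat (n ℕ.+ n) (n ℕ.+ n)) λ p₁ → Σ (Mat (n ℕ.+ n) (n ℕ.+ n)) λ p₂ →
                 InP n p₁ × InP n p₂ × (g ≈ ((p₁ ⊗ σ n s) ⊗ p₂))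

  Enumerates : ∀ {m} → List (Mat m m) → (Mat m m → Set) → Set
  Enumerates gs S = (∀ g → S g → Any (λ h → g ≈ h) gs)
                  × (∀ g → Any (λ h → g ≈ h) gs → S g)
                  × AllPairs (λ g h → ¬ (g ≈ h)) gs

  codeSum : ∀ {m} (gs : List (Mat m m)) → Vec Bool (length gs) → Carrier
  codeSum []       []       = 0#
  codeSum (g ∷ gs) (b ∷ u)  = (if b then tr g else 0#) + codeSum gs u

  inCode : ∀ {m} (gs : List (Mat m m)) → Vec Bool (length gs) → Bool
  inCode gs u = does (codeSum gs u ≟ 0#)

weight : ∀ {N} → Vec Bool N → ℕ
weight []          = 0
weight (true  ∷ u) = suc (weight u)
weight (false ∷ u) = weight u

allWords : ∀ N → List (Vec Bool N)
allWords zero    = [] ∷ []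
allWords (suc N) = map (true ∷_) (allWords N) ++ map (false ∷_) (allWords N)

module Code (𝔽 : FiniteField) where
  open Matrices 𝔽
  open import Data.Nat using (_≡ᵇ_)

  weightDist : ∀ {m} (gs : List (Mat m m)) → ℕ → ℕ
  weightDist gs j =
    length (Data.List.filter (λ u → Data.Bool._≟_ (inCode gs u ∧ (weight u ≡ᵇ j)) true)
                             (allWords (length gs)))

module Submission where

-- The weight distribution of C(D) is symmetric because the traces of the
-- members of D sum to zero: then Σ_j (1 − u_j) Tr g_j = −Σ_j u_j Tr g_j, so
-- complementing a word maps C(D) onto itself and turns weight j into N − j.
--
-- The trace sum vanishes for every finite set D of 2n × 2n matrices that is
-- stable under multiplication, on either side, by the shears U X = ( 1 X ; 0 1 )
-- with X symmetric; every double coset P σ P is such a set, as the shears lie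
-- in P.  Multiplying on the right by U (E a), with E a the matrix unit at (a, a),
-- is a bijection of D that adds g(a, a) to the entry g(a, n + a); summing over D
-- shows that the entries g(a, a) sum to zero.  Multiplying on the left does the
-- same for g(n + a, n + a).  Neither the characteristic of the field, nor s in
-- P σ_s P, nor the parity of n plays a role.

open import Defs
import Data.Nat as ℕ
open ℕ using (ℕ; zero; suc; _≡ᵇ_)
import Data.Nat.Properties as ℕₚ
open import Data.Bool using (Bool; true; false; not; _∧_; if_then_else_)
import Data.Bool as Bool
open import Data.Vec using (Vec; []; _∷_)
import Data.Vec as Vec
open import Data.List using (List; []; _∷_; length; lookup; filter; map; _++_)
open import Data.List.Properties using (length-++; filter-++)
open import Data.List.Membership.Propositional using (_∈_)
open import Data.List.Membership.Propositional.Properties using (∈-lookup)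
open import Data.List.Relation.Unary.Any using (Any; here; there)
import Data.List.Relation.Unary.Any as Any
open import Data.List.Relation.Unary.All using (All; []; _∷_)
open import Data.List.Relation.Unary.AllPairs using (AllPairs; []; _∷_)
open import Data.Fin using (Fin; _↑ˡ_; _↑ʳ_; splitAt)
import Data.Fin as F
import Data.Fin.Properties as FP
open import Data.Sum using (inj₁; inj₂)
open import Data.Product using (∃₂; _,_; _×_; proj₁; proj₂)
open import Function using (_∘_)
open import Function.Bundles using (mk⇔)
open import Level using (0ℓ)
open import Algebra.Bundles using (CommutativeRing)
open import Algebra.Structures using (IsCommutativeRing)
import Algebra.Properties.Semiring.Sum as SemiringSum
open import Relation.Nullary using (Dec; yes; no; does; ¬_)
open import Relation.Nullary.Decidable using (does-⇔; dec-true; dec-false)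
open import Relation.Nullary.Negation using (contradiction)
open import Relation.Binary.Bundles using (Setoid)
import Relation.Binary.Reasoning.Setoid as SetoidReasoning
open import Relation.Binary.PropositionalEquality

complement : ∀ {N} → Vec Bool N → Vec Bool N
complement = Vec.map not

weight-≤ : ∀ {N} (u : Vec Bool N) → weight u ℕ.≤ N
weight-≤ []          = ℕ.z≤n
weight-≤ (true ∷ u)  = ℕ.s≤s (weight-≤ u)
weight-≤ (false ∷ u) = ℕₚ.m≤n⇒m≤1+n (weight-≤ u)

weight-complement : ∀ {N} (u : Vec Bool N) → weight (complement u) ≡ N ℕ.∸ weight u
weight-complement []                = refl
weight-complement (true ∷ u)        = weight-complement u
weight-complement {suc N} (false ∷ u) =
  trans (cong suc (weight-complement u)) (sym (ℕₚ.+-∸-assoc 1 (weight-≤ u)))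

count : ∀ {A : Set} → (A → Bool) → List A → ℕ
count b xs = length (filter (λ x → b x Bool.≟ true) xs)

count-++ : ∀ {A : Set} (b : A → Bool) xs ys → count b (xs ++ ys) ≡ count b xs ℕ.+ count b ys
count-++ b xs ys =
  trans (cong length (filter-++ (λ x → b x Bool.≟ true) xs ys)) (length-++ (filter _ xs))

count-map : ∀ {A B : Set} (b : B → Bool) (f : A → B) xs → count b (map f xs) ≡ count (λ x → b (f x)) xs
count-map b f []       = refl
count-map b f (x ∷ xs) with b (f x)
... | true  = cong suc (count-map b f xs)
... | false = count-map b f xs

count-cong : ∀ {A : Set} {b c : A → Bool} → (∀ x → b x ≡ c x) → ∀ xs → count b xs ≡ count c xs
count-cong b≗c []       = refl
count-cong {b = b} {c} b≗c (x ∷ xs) rewrite b≗c x with c x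
... | true  = cong suc (count-cong b≗c xs)
... | false = count-cong b≗c xs

-- Complementation permutes the words of length N, so counting the words that
-- pass a test b is the same as counting those whose complement passes it.
count-complement : ∀ N (b : Vec Bool N → Bool) →
  count b (allWords N) ≡ count (λ u → b (complement u)) (allWords N)
count-complement zero    b with b []
... | true  = refl
... | false = refl
count-complement (suc N) b = begin
  count b (map (true ∷_) A ++ map (false ∷_) A)
    ≡⟨ count-++ b (map (true ∷_) A) (map (false ∷_) A) ⟩
  count b (map (true ∷_) A) ℕ.+ count b (map (false ∷_) A)
    ≡⟨ cong₂ ℕ._+_ (count-map b _ A) (count-map b _ A) ⟩
  count (λ u → b (true ∷ u)) A ℕ.+ count (λ u → b (false ∷ u)) A
    ≡⟨ cong₂ ℕ._+_ (count-complement N _) (count-complement N _) ⟩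
  count (λ u → b (true ∷ complement u)) A ℕ.+ count (λ u → b (false ∷ complement u)) A
    ≡⟨ ℕₚ.+-comm (count (λ u → b (true ∷ complement u)) A) _ ⟩
  count (λ u → b (false ∷ complement u)) A ℕ.+ count (λ u → b (true ∷ complement u)) A
    ≡⟨ cong₂ ℕ._+_ (count-map b′ _ A) (count-map b′ _ A) ⟨
  count b′ (map (true ∷_) A) ℕ.+ count b′ (map (false ∷_) A)
    ≡⟨ count-++ b′ (map (true ∷_) A) (map (false ∷_) A) ⟨
  count b′ (allWords (suc N)) ∎
  where
  open ≡-Reasoning
  A  = allWords N
  b′ = λ u → b (complement u)

weight-symmetry : ∀ N (inC : Vec Bool N → Bool) → (∀ u → inC (complement u) ≡ inC u) →
  ∀ j → j ℕ.≤ N →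
  count (λ u → inC u ∧ (weight u ≡ᵇ j)) (allWords N)
    ≡ count (λ u → inC u ∧ (weight u ≡ᵇ (N ℕ.∸ j))) (allWords N)
weight-symmetry N inC closed j j≤N =
  trans (count-complement N _) (count-cong (λ u → cong₂ _∧_ (closed u) (weight-flip u)) (allWords N))
  where
  weight-flip : ∀ u → (weight (complement u) ≡ᵇ j) ≡ (weight u ≡ᵇ (N ℕ.∸ j))
  weight-flip u rewrite weight-complement u = does-⇔ (mk⇔
    (λ e → trans (sym (ℕₚ.m∸[m∸n]≡n (weight-≤ u))) (cong (N ℕ.∸_) e))
    (λ e → trans (cong (N ℕ.∸_) e) (ℕₚ.m∸[m∸n]≡n j≤N)))
    (N ℕ.∸ weight u ℕₚ.≟ j) (weight u ℕₚ.≟ N ℕ.∸ j)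

module FieldMatrices (𝔽 : FiniteField) where
  open FiniteField 𝔽
  open Matrices 𝔽
  open IsCommutativeRing isCommutativeRing hiding (refl; sym; trans)

  ring : CommutativeRing 0ℓ 0ℓ
  ring = record { isCommutativeRing = isCommutativeRing }

  module LibrarySum = SemiringSum (CommutativeRing.semiring ring)
  open LibrarySum using (sum)
  open import Algebra.Properties.Group (CommutativeRing.+-group ring) using (identityˡ-unique)
  open import Algebra.Properties.CommutativeSemigroup (CommutativeRing.+-commutativeSemigroup ring)
    using (interchange)

  ∑≡sum : ∀ k (f : Fin k → Carrier) → ∑ k f ≡ sum f
  ∑≡sum zero    f = refl
  ∑≡sum (suc k) f = cong (f F.zero +_) (∑≡sum k (f ∘ F.suc))

  ∑-cong : ∀ k {f g : Fin k → Carrier} → (∀ i → f i ≡ g i) → ∑ k f ≡ ∑ k g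
  ∑-cong k {f} {g} f≗g = trans (∑≡sum k f) (trans (LibrarySum.sum-cong-≗ f≗g) (sym (∑≡sum k g)))

  ∑-+ : ∀ k (f g : Fin k → Carrier) → ∑ k (λ i → f i + g i) ≡ ∑ k f + ∑ k g
  ∑-+ k f g = begin
    ∑ k (λ i → f i + g i) ≡⟨ ∑≡sum k _ ⟩
    sum (λ i → f i + g i) ≡⟨ LibrarySum.∑-distrib-+ f g ⟩
    sum f + sum g         ≡⟨ cong₂ _+_ (∑≡sum k f) (∑≡sum k g) ⟨
    ∑ k f + ∑ k g         ∎
    where open ≡-Reasoning

  ∑-zero : ∀ k → ∑ k (λ _ → 0#) ≡ 0#
  ∑-zero k = trans (∑≡sum k _) (LibrarySum.sum-replicate-zero k)

  ∑-*ˡ : ∀ k c (f : Fin k → Carrier) → c * ∑ k f ≡ ∑ k (λ i → c * f i)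
  ∑-*ˡ k c f = trans (cong (c *_) (∑≡sum k f)) (trans (LibrarySum.*-distribˡ-sum c f) (sym (∑≡sum k _)))

  ∑-*ʳ : ∀ k c (f : Fin k → Carrier) → ∑ k f * c ≡ ∑ k (λ i → f i * c)
  ∑-*ʳ k c f = trans (cong (_* c) (∑≡sum k f)) (trans (LibrarySum.*-distribʳ-sum c f) (sym (∑≡sum k _)))

  ∑-comm : ∀ a b (F : Fin a → Fin b → Carrier) →
    ∑ a (λ i → ∑ b (F i)) ≡ ∑ b (λ j → ∑ a (λ i → F i j))
  ∑-comm a b F = begin
    ∑ a (λ i → ∑ b (F i))                   ≡⟨ trans (∑≡sum a _) (LibrarySum.sum-cong-≗ (λ i → ∑≡sum b (F i))) ⟩
    sum (λ i → sum (F i))                   ≡⟨ LibrarySum.∑-comm F ⟩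
    sum (λ j → sum (λ i → F i j))           ≡⟨ trans (∑≡sum b _) (LibrarySum.sum-cong-≗ {b} (λ j → ∑≡sum a (λ i → F i j))) ⟨
    ∑ b (λ j → ∑ a (λ i → F i j))           ∎
    where open ≡-Reasoning

  ∑-split : ∀ m n (f : Fin (m ℕ.+ n) → Carrier) →
    ∑ (m ℕ.+ n) f ≡ ∑ m (λ i → f (i ↑ˡ n)) + ∑ n (λ i → f (m ↑ʳ i))
  ∑-split zero    n f = sym (+-identityˡ _)
  ∑-split (suc m) n f = trans (cong (f F.zero +_) (∑-split m n (f ∘ F.suc))) (sym (+-assoc _ _ _))
  δ-≡ : ∀ {m} (i : Fin m) → δ i i ≡ 1#
  δ-≡ i with i F.≟ i
  ... | yes _   = refl
  ... | no  i≢i = contradiction refl i≢i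

  δ-≢ : ∀ {m} (i j : Fin m) → i ≢ j → δ i j ≡ 0#
  δ-≢ i j i≢j with i F.≟ j
  ... | yes i≡j = contradiction i≡j i≢j
  ... | no  _   = refl

  δ-sym : ∀ {m} (i j : Fin m) → δ i j ≡ δ j i
  δ-sym i j with i F.≟ j
  ... | yes refl = sym (δ-≡ i)
  ... | no  i≢j  = sym (δ-≢ j i (i≢j ∘ sym))

  δ-injective : ∀ {m k} (f : Fin m → Fin k) → (∀ {a b} → f a ≡ f b → a ≡ b) →
    ∀ a b → δ (f a) (f b) ≡ δ a b
  δ-injective f f-inj a b with a F.≟ b
  ... | yes refl = δ-≡ (f a)
  ... | no  a≢b  = δ-≢ (f a) (f b) (a≢b ∘ f-inj)

  ∑-δʳ : ∀ k (x : Fin k → Carrier) (j : Fin k) → ∑ k (λ t → x t * δ t j) ≡ x j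
  ∑-δʳ (suc k) x F.zero = begin
    x F.zero * δ {suc k} F.zero F.zero + ∑ k (λ t → x (F.suc t) * δ (F.suc t) F.zero)
      ≡⟨ cong₂ _+_ (cong (x F.zero *_) (δ-≡ {suc k} F.zero))
                   (∑-cong k (λ t → cong (x (F.suc t) *_) (δ-≢ (F.suc t) F.zero λ ()))) ⟩
    x F.zero * 1# + ∑ k (λ t → x (F.suc t) * 0#)
      ≡⟨ cong₂ _+_ (*-identityʳ _) (trans (∑-cong k (λ t → zeroʳ _)) (∑-zero k)) ⟩
    x F.zero + 0#   ≡⟨ +-identityʳ _ ⟩
    x F.zero        ∎
    where open ≡-Reasoning
  ∑-δʳ (suc k) x (F.suc j) = begin
    x F.zero * δ F.zero (F.suc j) + ∑ k (λ t → x (F.suc t) * δ (F.suc t) (F.suc j))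
      ≡⟨ cong₂ _+_ (trans (cong (x F.zero *_) (δ-≢ F.zero (F.suc j) λ ())) (zeroʳ _))
                   (∑-cong k (λ t → cong (x (F.suc t) *_) (δ-injective F.suc FP.suc-injective t j))) ⟩
    0# + ∑ k (λ t → x (F.suc t) * δ t j) ≡⟨ +-identityˡ _ ⟩
    ∑ k (λ t → x (F.suc t) * δ t j)      ≡⟨ ∑-δʳ k (x ∘ F.suc) j ⟩
    x (F.suc j)                          ∎
    where open ≡-Reasoning

  ∑-δˡ : ∀ k (x : Fin k → Carrier) (j : Fin k) → ∑ k (λ t → δ j t * x t) ≡ x j
  ∑-δˡ k x j = trans (∑-cong k (λ t → trans (*-comm _ _) (cong (x t *_) (δ-sym j t)))) (∑-δʳ k x j)

  Mat-setoid : ℕ → ℕ → Setoid 0ℓ 0ℓ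
  Mat-setoid m k = record
    { Carrier       = Mat m k
    ; _≈_           = _≈_
    ; isEquivalence = record
      { refl  = λ _ _ → refl
      ; sym   = λ X≈Y i j → sym (X≈Y i j)
      ; trans = λ X≈Y Y≈Z i j → trans (X≈Y i j) (Y≈Z i j) } }

  module _ {m k : ℕ} where
    open Setoid (Mat-setoid m k) public
      using () renaming (refl to ≈-refl; sym to ≈-sym; trans to ≈-trans)

  _⊕_ : ∀ {m k} → Mat m k → Mat m k → Mat m k
  (X ⊕ Y) i j = X i j + Y i j

  neg : ∀ {m k} → Mat m k → Mat m k
  neg X i j = - X i j

  ⊗-cong : ∀ {m k l} {X X′ : Mat m k} {Y Y′ : Mat k l} → X ≈ X′ → Y ≈ Y′ → (X ⊗ Y) ≈ (X′ ⊗ Y′)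
  ⊗-cong {k = k} X≈X′ Y≈Y′ i j = ∑-cong k (λ t → cong₂ _*_ (X≈X′ i t) (Y≈Y′ t j))

  ⊗-congˡ : ∀ {m k l} (X : Mat m k) {Y Y′ : Mat k l} → Y ≈ Y′ → (X ⊗ Y) ≈ (X ⊗ Y′)
  ⊗-congˡ X = ⊗-cong {X = X} ≈-refl

  ⊗-congʳ : ∀ {m k l} {X X′ : Mat m k} (Y : Mat k l) → X ≈ X′ → (X ⊗ Y) ≈ (X′ ⊗ Y)
  ⊗-congʳ Y X≈X′ = ⊗-cong {Y = Y} X≈X′ ≈-refl

  ⊗-assoc : ∀ {m k l p} (X : Mat m k) (Y : Mat k l) (Z : Mat l p) → ((X ⊗ Y) ⊗ Z) ≈ (X ⊗ (Y ⊗ Z))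
  ⊗-assoc {k = k} {l = l} X Y Z i j = begin
    ∑ l (λ t → ∑ k (λ s → X i s * Y s t) * Z t j)
      ≡⟨ ∑-cong l (λ t → trans (∑-*ʳ k (Z t j) _) (∑-cong k (λ s → *-assoc _ _ _))) ⟩
    ∑ l (λ t → ∑ k (λ s → X i s * (Y s t * Z t j))) ≡⟨ ∑-comm l k _ ⟩
    ∑ k (λ s → ∑ l (λ t → X i s * (Y s t * Z t j))) ≡⟨ ∑-cong k (λ s → ∑-*ˡ l (X i s) _) ⟨
    ∑ k (λ s → X i s * ∑ l (λ t → Y s t * Z t j))   ∎
    where open ≡-Reasoning

  ⊗-identityˡ : ∀ {m k} (X : Mat m k) → (𝟙 ⊗ X) ≈ X
  ⊗-identityˡ {m} X i j = ∑-δˡ m (λ t → X t j) i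

  ⊗-identityʳ : ∀ {m k} (X : Mat m k) → (X ⊗ 𝟙) ≈ X
  ⊗-identityʳ {k = k} X i j = ∑-δʳ k (X i) j

  ⊗-zeroˡ : ∀ {m k l} (X : Mat k l) → (𝟘 {m} ⊗ X) ≈ 𝟘
  ⊗-zeroˡ {k = k} X i j = trans (∑-cong k (λ t → zeroˡ _)) (∑-zero k)

  ⊗-zeroʳ : ∀ {m k l} (X : Mat m k) → (X ⊗ 𝟘 {k} {l}) ≈ 𝟘
  ⊗-zeroʳ {k = k} X i j = trans (∑-cong k (λ t → zeroʳ _)) (∑-zero k)

  transpose-⊗ : ∀ {m k l} (X : Mat m k) (Y : Mat k l) → transpose (X ⊗ Y) ≈ (transpose Y ⊗ transpose X)
  transpose-⊗ {k = k} X Y i j = ∑-cong k (λ t → *-comm _ _)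

  ⊕-zeroʳ : ∀ {m k} {X Y Z : Mat m k} → X ≈ Z → Y ≈ 𝟘 → (X ⊕ Y) ≈ Z
  ⊕-zeroʳ X≈Z Y≈𝟘 i j = trans (cong₂ _+_ (X≈Z i j) (Y≈𝟘 i j)) (+-identityʳ _)

  ⊕-zeroˡ : ∀ {m k} {X Y Z : Mat m k} → X ≈ 𝟘 → Y ≈ Z → (X ⊕ Y) ≈ Z
  ⊕-zeroˡ X≈𝟘 Y≈Z i j = trans (cong₂ _+_ (X≈𝟘 i j) (Y≈Z i j)) (+-identityˡ _)

  symmetric-congruence : ∀ {n k} (A : Mat k n) {X : Mat n n} → Symmetric X →
    Symmetric (A ⊗ (X ⊗ transpose A))
  symmetric-congruence {k = k} A {X} X-sym = begin
    transpose (A ⊗ (X ⊗ transpose A))           ≈⟨ transpose-⊗ A (X ⊗ transpose A) ⟩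
    transpose (X ⊗ transpose A) ⊗ transpose A   ≈⟨ ⊗-congʳ (transpose A) (transpose-⊗ X (transpose A)) ⟩
    (A ⊗ transpose X) ⊗ transpose A             ≈⟨ ⊗-congʳ (transpose A) (⊗-congˡ A X-sym) ⟩
    (A ⊗ X) ⊗ transpose A                       ≈⟨ ⊗-assoc A X (transpose A) ⟩
    A ⊗ (X ⊗ transpose A)                       ∎
    where open SetoidReasoning (Mat-setoid k k)

  data Half : Set where
    upper lower : Half

  embed : ∀ {n} → Half → Fin n → Fin (n ℕ.+ n)
  embed {n} upper a = a ↑ˡ n
  embed {n} lower a = n ↑ʳ a

  embed-surjective : ∀ n (i : Fin (n ℕ.+ n)) → ∃₂ λ h a → embed {n} h a ≡ i
  embed-surjective n i with splitAt n i in eq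
  ... | inj₁ a = upper , a , FP.splitAt⁻¹-↑ˡ eq
  ... | inj₂ a = lower , a , FP.splitAt⁻¹-↑ʳ eq

  embed-injective : ∀ {n} h {a b : Fin n} → embed h a ≡ embed h b → a ≡ b
  embed-injective {n} upper = FP.↑ˡ-injective n _ _
  embed-injective {n} lower = FP.↑ʳ-injective n _ _

  embed-disjoint : ∀ {n} (a b : Fin n) → embed upper a ≢ embed lower b
  embed-disjoint {n} a b eq
    with () ← trans (sym (FP.splitAt-↑ˡ n a n)) (trans (cong (splitAt n) eq) (FP.splitAt-↑ʳ n n b))

  quadrant : ∀ {n} → Mat (n ℕ.+ n) (n ℕ.+ n) → Half → Half → Mat n n
  quadrant {n} M h h′ a b = M (embed {n} h a) (embed {n} h′ b)

  quadrant-ext : ∀ {n} {M N : Mat (n ℕ.+ n) (n ℕ.+ n)} →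
    (∀ h h′ → quadrant {n} M h h′ ≈ quadrant {n} N h h′) → M ≈ N
  quadrant-ext {n} M≈N i j with embed-surjective n i | embed-surjective n j
  ... | h , a , refl | h′ , b , refl = M≈N h h′ a b

  _⊠_ : ∀ {n} → (Half → Half → Mat n n) → (Half → Half → Mat n n) → Half → Half → Mat n n
  (Q ⊠ Q′) h h′ = (Q h upper ⊗ Q′ upper h′) ⊕ (Q h lower ⊗ Q′ lower h′)

  quadrant-⊗ : ∀ {n} (M N : Mat (n ℕ.+ n) (n ℕ.+ n)) h h′ →
    quadrant {n} (M ⊗ N) h h′ ≈ (quadrant {n} M ⊠ quadrant {n} N) h h′
  quadrant-⊗ {n} M N h h′ a b = ∑-split n n _

  blockQuadrant : ∀ {n} → Mat n n → Mat n n → Mat n n → Mat n n → Half → Half → Mat n n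
  blockQuadrant X Y Z W upper upper = X
  blockQuadrant X Y Z W upper lower = Y
  blockQuadrant X Y Z W lower upper = Z
  blockQuadrant X Y Z W lower lower = W

  quadrant-block : ∀ {n} (X Y Z W : Mat n n) h h′ → quadrant {n} (block {n} X Y Z W) h h′ ≈ blockQuadrant X Y Z W h h′
  quadrant-block {n} X Y Z W upper upper a b rewrite FP.splitAt-↑ˡ n a n | FP.splitAt-↑ˡ n b n = refl
  quadrant-block {n} X Y Z W upper lower a b rewrite FP.splitAt-↑ˡ n a n | FP.splitAt-↑ʳ n n b = refl
  quadrant-block {n} X Y Z W lower upper a b rewrite FP.splitAt-↑ʳ n n a | FP.splitAt-↑ˡ n b n = refl
  quadrant-block {n} X Y Z W lower lower a b rewrite FP.splitAt-↑ʳ n n a | FP.splitAt-↑ʳ n n b = refl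

  block-ext : ∀ {n} {M : Mat (n ℕ.+ n) (n ℕ.+ n)} (X Y Z W : Mat n n) →
    (∀ h h′ → quadrant {n} M h h′ ≈ blockQuadrant X Y Z W h h′) → M ≈ block {n} X Y Z W
  block-ext X Y Z W M≈ = quadrant-ext λ h h′ → ≈-trans (M≈ h h′) (≈-sym (quadrant-block X Y Z W h h′))

  block-⊗-block : ∀ {n} (X Y Z W X′ Y′ Z′ W′ : Mat n n) {X″ Y″ Z″ W″ : Mat n n} →
    (∀ h h′ → (blockQuadrant X Y Z W ⊠ blockQuadrant X′ Y′ Z′ W′) h h′ ≈ blockQuadrant X″ Y″ Z″ W″ h h′) →
    (block {n} X Y Z W ⊗ block {n} X′ Y′ Z′ W′) ≈ block {n} X″ Y″ Z″ W″
  block-⊗-block X Y Z W X′ Y′ Z′ W′ {X″} {Y″} {Z″} {W″} products =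
    block-ext X″ Y″ Z″ W″ λ h h′ → ≈-trans (quadrant-⊗ (block X Y Z W) (block X′ Y′ Z′ W′) h h′)
      (≈-trans (λ a b → cong₂ _+_
         (⊗-cong (quadrant-block X Y Z W h upper) (quadrant-block X′ Y′ Z′ W′ upper h′) a b)
         (⊗-cong (quadrant-block X Y Z W h lower) (quadrant-block X′ Y′ Z′ W′ lower h′) a b))
       (products h h′))

  𝟙-block : ∀ {n} → 𝟙 ≈ block {n} 𝟙 𝟘 𝟘 𝟙
  𝟙-block {n} = block-ext 𝟙 𝟘 𝟘 𝟙 quadrants
    where
    quadrants : ∀ h h′ → quadrant {n} 𝟙 h h′ ≈ blockQuadrant 𝟙 𝟘 𝟘 𝟙 h h′
    quadrants upper upper = δ-injective (embed upper) (embed-injective upper)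
    quadrants upper lower a b = δ-≢ (embed upper a) (embed lower b) (embed-disjoint a b)
    quadrants lower upper a b = δ-≢ (embed lower a) (embed upper b) (embed-disjoint b a ∘ sym)
    quadrants lower lower = δ-injective (embed lower) (embed-injective lower)

  U : ∀ {n} → Mat n n → Mat (n ℕ.+ n) (n ℕ.+ n)
  U {n} X = block {n} 𝟙 X 𝟘 𝟙

  diag : ∀ {n} → Mat n n → Mat n n → Mat (n ℕ.+ n) (n ℕ.+ n)
  diag {n} A C = block {n} A 𝟘 𝟘 C

  U-⊗ : ∀ {n} {X Y Z : Mat n n} → (X ⊕ Y) ≈ Z → (U X ⊗ U Y) ≈ U Z
  U-⊗ {n} {X} {Y} {Z} X⊕Y≈Z = block-⊗-block 𝟙 X 𝟘 𝟙 𝟙 Y 𝟘 𝟙 products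
    where
    products : ∀ h h′ → (blockQuadrant 𝟙 X 𝟘 𝟙 ⊠ blockQuadrant 𝟙 Y 𝟘 𝟙) h h′ ≈ blockQuadrant 𝟙 Z 𝟘 𝟙 h h′
    products upper upper = ⊕-zeroʳ (⊗-identityˡ 𝟙) (⊗-zeroʳ X)
    products upper lower a b =
      trans (trans (cong₂ _+_ (⊗-identityˡ Y a b) (⊗-identityʳ X a b)) (+-comm _ _)) (X⊕Y≈Z a b)
    products lower upper = ⊕-zeroʳ (⊗-zeroˡ 𝟙) (⊗-zeroʳ 𝟙)
    products lower lower = ⊕-zeroˡ (⊗-zeroˡ Y) (⊗-identityˡ 𝟙)

  U-inverseʳ : ∀ {n} (X : Mat n n) → (U X ⊗ U (neg X)) ≈ 𝟙
  U-inverseʳ {n} X = ≈-trans (U-⊗ {n} (λ i j → -‿inverseʳ (X i j))) (≈-sym (𝟙-block {n}))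

  U-inverseˡ : ∀ {n} (X : Mat n n) → (U (neg X) ⊗ U X) ≈ 𝟙
  U-inverseˡ {n} X = ≈-trans (U-⊗ {n} (λ i j → -‿inverseˡ (X i j))) (≈-sym (𝟙-block {n}))

  U-⊗-diag : ∀ {n} (X A C : Mat n n) → (U X ⊗ diag A C) ≈ block {n} A (X ⊗ C) 𝟘 C
  U-⊗-diag {n} X A C = block-⊗-block 𝟙 X 𝟘 𝟙 A 𝟘 𝟘 C products
    where
    products : ∀ h h′ → (blockQuadrant 𝟙 X 𝟘 𝟙 ⊠ blockQuadrant A 𝟘 𝟘 C) h h′ ≈ blockQuadrant A (X ⊗ C) 𝟘 C h h′
    products upper upper = ⊕-zeroʳ (⊗-identityˡ A) (⊗-zeroʳ X)
    products upper lower = ⊕-zeroˡ (⊗-zeroʳ 𝟙) ≈-refl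
    products lower upper = ⊕-zeroʳ (⊗-zeroˡ A) (⊗-zeroʳ 𝟙)
    products lower lower = ⊕-zeroˡ (⊗-zeroˡ {n} {n} {n} 𝟘) (⊗-identityˡ C)

  diag-⊗-U : ∀ {n} (A C : Mat n n) {Y Z : Mat n n} → (A ⊗ Y) ≈ Z → (diag A C ⊗ U Y) ≈ block {n} A Z 𝟘 C
  diag-⊗-U {n} A C {Y} {Z} AY≈Z = block-⊗-block A 𝟘 𝟘 C 𝟙 Y 𝟘 𝟙 products
    where
    products : ∀ h h′ → (blockQuadrant A 𝟘 𝟘 C ⊠ blockQuadrant 𝟙 Y 𝟘 𝟙) h h′ ≈ blockQuadrant A Z 𝟘 C h h′
    products upper upper = ⊕-zeroʳ (⊗-identityʳ A) (⊗-zeroˡ {n} {n} {n} 𝟘)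
    products upper lower = ⊕-zeroʳ AY≈Z (⊗-zeroˡ 𝟙)
    products lower upper = ⊕-zeroʳ (⊗-zeroˡ 𝟙) (⊗-zeroʳ C)
    products lower lower = ⊕-zeroˡ (⊗-zeroˡ Y) (⊗-identityʳ C)

  U-conjugate : ∀ {n} {A A′ : Mat n n} (X C : Mat n n) → (A ⊗ A′) ≈ 𝟙 →
    (U X ⊗ diag A C) ≈ (diag A C ⊗ U (A′ ⊗ (X ⊗ C)))
  U-conjugate {A = A} {A′} X C AA′≈𝟙 =
    ≈-trans (U-⊗-diag X A C) (≈-sym (diag-⊗-U A C A⊗A′XC≈XC))
    where
    A⊗A′XC≈XC : (A ⊗ (A′ ⊗ (X ⊗ C))) ≈ (X ⊗ C)
    A⊗A′XC≈XC = ≈-trans (≈-sym (⊗-assoc A A′ (X ⊗ C))) (≈-trans (⊗-congʳ (X ⊗ C) AA′≈𝟙) (⊗-identityˡ (X ⊗ C)))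

  -- P is closed under multiplication by symmetric shears on either side: on the
  -- right the shears merge, on the left U X is first moved past diag A ᵗA⁻¹.
  P-⊗-U : ∀ {n p} {X : Mat n n} → InP n p → Symmetric X → InP n (p ⊗ U X)
  P-⊗-U {n} {p} {X} (A , A′ , B , AA′≈𝟙 , A′A≈𝟙 , B-sym , p≈) X-sym =
    A , A′ , (B ⊕ X) , AA′≈𝟙 , A′A≈𝟙 , (λ i j → cong₂ _+_ (B-sym i j) (X-sym i j)) , (begin
      p ⊗ U X                ≈⟨ ⊗-congʳ (U X) p≈ ⟩
      (D ⊗ U B) ⊗ U X        ≈⟨ ⊗-assoc D (U B) (U X) ⟩
      D ⊗ (U B ⊗ U X)        ≈⟨ ⊗-congˡ D (U-⊗ {n} {B} {X} ≈-refl) ⟩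
      D ⊗ U (B ⊕ X)          ∎)
    where
    open SetoidReasoning (Mat-setoid (n ℕ.+ n) (n ℕ.+ n))
    D : Mat (n ℕ.+ n) (n ℕ.+ n)
    D = diag A (transpose A′)

  U-⊗-P : ∀ {n p} {X : Mat n n} → InP n p → Symmetric X → InP n (U X ⊗ p)
  U-⊗-P {n} {p} {X} (A , A′ , B , AA′≈𝟙 , A′A≈𝟙 , B-sym , p≈) X-sym =
    A , A′ , (Y ⊕ B) , AA′≈𝟙 , A′A≈𝟙 , (λ i j → cong₂ _+_ (Y-sym i j) (B-sym i j)) , (begin
      U X ⊗ p                ≈⟨ ⊗-congˡ (U X) p≈ ⟩
      U X ⊗ (D ⊗ U B)        ≈⟨ ⊗-assoc (U X) D (U B) ⟨
      (U X ⊗ D) ⊗ U B        ≈⟨ ⊗-congʳ (U B) (U-conjugate X (transpose A′) AA′≈𝟙) ⟩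
      (D ⊗ U Y) ⊗ U B        ≈⟨ ⊗-assoc D (U Y) (U B) ⟩
      D ⊗ (U Y ⊗ U B)        ≈⟨ ⊗-congˡ D (U-⊗ {n} {Y} {B} ≈-refl) ⟩
      D ⊗ U (Y ⊕ B)          ∎)
    where
    open SetoidReasoning (Mat-setoid (n ℕ.+ n) (n ℕ.+ n))
    D : Mat (n ℕ.+ n) (n ℕ.+ n)
    D = diag A (transpose A′)
    Y : Mat n n
    Y = A′ ⊗ (X ⊗ transpose A′)
    Y-sym : Symmetric Y
    Y-sym = symmetric-congruence A′ X-sym

  ShearStable : ∀ n → (Mat (n ℕ.+ n) (n ℕ.+ n) → Set) → Set
  ShearStable n S = ∀ {g} {X : Mat n n} → Symmetric X → S g → S (g ⊗ U X) × S (U X ⊗ g)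

  -- Every double coset P σ P is shear-stable, since the shears lie in P.
  doubleCoset-shearStable : ∀ n s → ShearStable n (InDC n s)
  doubleCoset-shearStable n s {g} {X} X-sym (p₁ , p₂ , p₁∈P , p₂∈P , g≈) =
    (p₁ , (p₂ ⊗ U X) , p₁∈P , P-⊗-U p₂∈P X-sym ,
       ≈-trans (⊗-congʳ (U X) g≈) (⊗-assoc (p₁ ⊗ σ n s) p₂ (U X))) ,
    ((U X ⊗ p₁) , p₂ , U-⊗-P p₁∈P X-sym , p₂∈P ,
       ≈-trans (⊗-congˡ (U X) g≈) (≈-trans (≈-sym (⊗-assoc (U X) (p₁ ⊗ σ n s) p₂))
         (⊗-congʳ p₂ (≈-sym (⊗-assoc (U X) p₁ (σ n s))))))

  Σl : ∀ {A : Set} → List A → (A → Carrier) → Carrier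
  Σl xs f = ∑ (length xs) (λ i → f (lookup xs i))

  Σl-cong : ∀ {A : Set} (xs : List A) {f g : A → Carrier} → (∀ x → x ∈ xs → f x ≡ g x) → Σl xs f ≡ Σl xs g
  Σl-cong xs f≗g = ∑-cong (length xs) (λ i → f≗g (lookup xs i) (∈-lookup i))

  Σl-+ : ∀ {A : Set} (xs : List A) (f g : A → Carrier) → Σl xs (λ x → f x + g x) ≡ Σl xs f + Σl xs g
  Σl-+ xs f g = ∑-+ (length xs) _ _

  Σl-comm : ∀ {A B : Set} (xs : List A) (ys : List B) (F : A → B → Carrier) →
    Σl xs (λ x → Σl ys (F x)) ≡ Σl ys (λ y → Σl xs (λ x → F x y))
  Σl-comm xs ys F = ∑-comm (length xs) (length ys) _

  Σl-∑ : ∀ {A : Set} (xs : List A) k (F : A → Fin k → Carrier) →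
    Σl xs (λ x → ∑ k (F x)) ≡ ∑ k (λ i → Σl xs (λ x → F x i))
  Σl-∑ xs k F = ∑-comm (length xs) k _

  _≈?_ : ∀ {m} (X Y : Mat m m) → Dec (X ≈ Y)
  X ≈? Y = FP.all? (λ i → FP.all? (λ j → X i j ≟ Y i j))

  indicator : ∀ {m} → Mat m m → Mat m m → Carrier → Carrier
  indicator Z Y c = if does (Z ≈? Y) then c else 0#

  indicator-⇔ : ∀ {m} {Z Y Z′ Y′ : Mat m m} c → (Z ≈ Y → Z′ ≈ Y′) → (Z′ ≈ Y′ → Z ≈ Y) →
    indicator Z Y c ≡ indicator Z′ Y′ c
  indicator-⇔ {Z = Z} {Y} {Z′} {Y′} c to from =
    cong (if_then c else 0#) (does-⇔ (mk⇔ to from) (Z ≈? Y) (Z′ ≈? Y′))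

  indicator-yes : ∀ {m} {Z Y : Mat m m} c → Z ≈ Y → indicator Z Y c ≡ c
  indicator-yes {Z = Z} {Y} c Z≈Y = cong (if_then c else 0#) (dec-true (Z ≈? Y) Z≈Y)

  indicator-no : ∀ {m} {Z Y : Mat m m} c → ¬ Z ≈ Y → indicator Z Y c ≡ 0#
  indicator-no {Z = Z} {Y} c Z≉Y = cong (if_then c else 0#) (dec-false (Z ≈? Y) Z≉Y)

  Σl-indicator : ∀ {m} (xs : List (Mat m m)) → AllPairs (λ g h → ¬ g ≈ h) xs →
    ∀ Z (f : Mat m m → Carrier) → (∀ {X Y} → X ≈ Y → f X ≡ f Y) →
    Any (λ h → Z ≈ h) xs → Σl xs (λ y → indicator Z y (f y)) ≡ f Z
  Σl-indicator (x ∷ xs) (x≉xs ∷ distinct) Z f f-resp Z∈ with Z ≈? x | Z∈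
  ... | yes Z≈x | _ = begin
    indicator Z x (f x) + Σl xs (λ y → indicator Z y (f y))
      ≡⟨ cong₂ _+_ (indicator-yes (f x) Z≈x) (Σl-none x≉xs) ⟩
    f x + 0#   ≡⟨ +-identityʳ (f x) ⟩
    f x        ≡⟨ f-resp (≈-sym Z≈x) ⟩
    f Z        ∎
    where
    open ≡-Reasoning
    -- the other entries differ from x ≈ Z, so they contribute nothing
    Σl-none : ∀ {ys} → All (λ y → ¬ x ≈ y) ys → Σl ys (λ y → indicator Z y (f y)) ≡ 0#
    Σl-none []                  = refl
    Σl-none {y ∷ _} (x≉y ∷ x≉ys) = trans (cong₂ _+_ (indicator-no (f y) (x≉y ∘ ≈-trans (≈-sym Z≈x))) (Σl-none x≉ys))
                                       (+-identityˡ 0#)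
  ... | no Z≉x | here Z≈x   = contradiction Z≈x Z≉x
  ... | no Z≉x | there Z∈xs =
    trans (cong₂ _+_ (indicator-no (f x) Z≉x) (Σl-indicator xs distinct Z f f-resp Z∈xs)) (+-identityˡ (f Z))

  record SelfBijection {m} (S : Mat m m → Set) : Set where
    field
      to from     : Mat m m → Mat m m
      to-cong     : ∀ {X Y} → X ≈ Y → to X ≈ to Y
      from-cong   : ∀ {X Y} → X ≈ Y → from X ≈ from Y
      to-from     : ∀ X → to (from X) ≈ X
      from-to     : ∀ X → from (to X) ≈ X
      to-closed   : ∀ {X} → S X → S (to X)
      from-closed : ∀ {X} → S X → S (from X)

  -- Reindexing a sum over an enumeration of S along a bijection of S:
  -- Σ_x f (φ x) = Σ_x Σ_y [φ x ≈ y] f y = Σ_y Σ_x [x ≈ φ⁻¹ y] f y = Σ_y f y.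
  Σl-reindex : ∀ {m} {S : Mat m m → Set} (gs : List (Mat m m)) → Enumerates gs S →
    (φ : SelfBijection S) (f : Mat m m → Carrier) → (∀ {X Y} → X ≈ Y → f X ≡ f Y) →
    Σl gs (λ x → f (SelfBijection.to φ x)) ≡ Σl gs f
  Σl-reindex {S = S} gs (complete , sound , distinct) φ f f-resp = begin
    Σl gs (λ x → f (to x))
      ≡⟨ Σl-cong gs (λ x x∈gs → Σl-indicator gs distinct (to x) f f-resp (complete _ (to-closed (member x∈gs)))) ⟨
    Σl gs (λ x → Σl gs (λ y → indicator (to x) y (f y)))   ≡⟨ Σl-comm gs gs (λ x y → indicator (to x) y (f y)) ⟩
    Σl gs (λ y → Σl gs (λ x → indicator (to x) y (f y)))
      ≡⟨ Σl-cong gs (λ y _ → Σl-cong gs (λ x _ → indicator-⇔ (f y)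
           (λ tx≈y → ≈-trans (from-cong (≈-sym tx≈y)) (from-to x))
           (λ fy≈x → ≈-trans (to-cong (≈-sym fy≈x)) (to-from y)))) ⟩
    Σl gs (λ y → Σl gs (λ x → indicator (from y) x (f y)))
      ≡⟨ Σl-cong gs (λ y y∈gs → Σl-indicator gs distinct (from y) (λ _ → f y) (λ _ → refl)
           (complete _ (from-closed (member y∈gs)))) ⟩
    Σl gs f ∎
    where
    open ≡-Reasoning
    open SelfBijection φ
    member : ∀ {x} → x ∈ gs → S x
    member x∈gs = sound _ (Any.map (λ { refl → ≈-refl }) x∈gs)

  right-multiplication : ∀ {m} {S : Mat m m → Set} (V V′ : Mat m m) → (V ⊗ V′) ≈ 𝟙 → (V′ ⊗ V) ≈ 𝟙 →
    (∀ {X} → S X → S (X ⊗ V)) → (∀ {X} → S X → S (X ⊗ V′)) → SelfBijection S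
  right-multiplication V V′ VV′≈𝟙 V′V≈𝟙 closed closed′ = record
    { to = _⊗ V ; from = _⊗ V′
    ; to-cong = ⊗-congʳ V ; from-cong = ⊗-congʳ V′
    ; to-from = cancel V′ V V′V≈𝟙 ; from-to = cancel V V′ VV′≈𝟙
    ; to-closed = closed ; from-closed = closed′ }
    where
    cancel : ∀ W W′ → (W ⊗ W′) ≈ 𝟙 → ∀ X → ((X ⊗ W) ⊗ W′) ≈ X
    cancel W W′ WW′≈𝟙 X = ≈-trans (⊗-assoc X W W′) (≈-trans (⊗-congˡ X WW′≈𝟙) (⊗-identityʳ X))

  left-multiplication : ∀ {m} {S : Mat m m → Set} (V V′ : Mat m m) → (V ⊗ V′) ≈ 𝟙 → (V′ ⊗ V) ≈ 𝟙 →
    (∀ {X} → S X → S (V ⊗ X)) → (∀ {X} → S X → S (V′ ⊗ X)) → SelfBijection S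
  left-multiplication V V′ VV′≈𝟙 V′V≈𝟙 closed closed′ = record
    { to = V ⊗_ ; from = V′ ⊗_
    ; to-cong = ⊗-congˡ V ; from-cong = ⊗-congˡ V′
    ; to-from = cancel V V′ VV′≈𝟙 ; from-to = cancel V′ V V′V≈𝟙
    ; to-closed = closed ; from-closed = closed′ }
    where
    cancel : ∀ W W′ → (W ⊗ W′) ≈ 𝟙 → ∀ X → (W ⊗ (W′ ⊗ X)) ≈ X
    cancel W W′ WW′≈𝟙 X = ≈-trans (≈-sym (⊗-assoc W W′ X)) (≈-trans (⊗-congʳ X WW′≈𝟙) (⊗-identityˡ X))

  ⊗-U-entry : ∀ {n} (M : Mat (n ℕ.+ n) (n ℕ.+ n)) (X : Mat n n) a b →
    (M ⊗ U X) (embed upper a) (embed lower b) ≡ (quadrant {n} M upper upper ⊗ X) a b + M (embed upper a) (embed lower b)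
  ⊗-U-entry {n} M X a b = trans (quadrant-⊗ M (U X) upper lower a b) (cong₂ _+_
    (⊗-congˡ (quadrant {n} M upper upper) (quadrant-block 𝟙 X 𝟘 𝟙 upper lower) a b)
    (trans (⊗-congˡ (quadrant {n} M upper lower) (quadrant-block 𝟙 X 𝟘 𝟙 lower lower) a b)
           (⊗-identityʳ (quadrant {n} M upper lower) a b)))

  U-⊗-entry : ∀ {n} (M : Mat (n ℕ.+ n) (n ℕ.+ n)) (X : Mat n n) a b →
    (U X ⊗ M) (embed upper a) (embed lower b) ≡ M (embed upper a) (embed lower b) + (X ⊗ quadrant {n} M lower lower) a b
  U-⊗-entry {n} M X a b = trans (quadrant-⊗ (U X) M upper lower a b) (cong₂ _+_
    (trans (⊗-congʳ (quadrant {n} M upper lower) (quadrant-block 𝟙 X 𝟘 𝟙 upper upper) a b)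
           (⊗-identityˡ (quadrant {n} M upper lower) a b))
    (⊗-congʳ (quadrant {n} M lower lower) (quadrant-block 𝟙 X 𝟘 𝟙 upper lower) a b))

  E : ∀ {n} → Fin n → Mat n n
  E a s t = δ s a * δ a t

  E-symmetric : ∀ {n} (a : Fin n) → Symmetric (E a)
  E-symmetric a s t = trans (cong₂ _*_ (δ-sym t a) (δ-sym a s)) (*-comm _ _)

  ⊗-E : ∀ {n} (M : Mat n n) (a : Fin n) → (M ⊗ E a) a a ≡ M a a
  ⊗-E {n} M a = trans (∑-cong n λ t → cong (λ e → M a t * (δ t a * e)) (δ-≡ a))
    (trans (∑-cong n λ t → cong (M a t *_) (*-identityʳ _)) (∑-δʳ n (M a) a))

  E-⊗ : ∀ {n} (M : Mat n n) (a : Fin n) → (E a ⊗ M) a a ≡ M a a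
  E-⊗ {n} M a = trans (∑-cong n λ t → cong (λ e → e * δ a t * M t a) (δ-≡ a))
    (trans (∑-cong n λ t → cong (_* M t a) (*-identityˡ _)) (∑-δˡ n (λ t → M t a) a))

  Σl-absorbs : ∀ {A : Set} (xs : List A) (f d : A → Carrier) →
    Σl xs (λ x → d x + f x) ≡ Σl xs f → Σl xs d ≡ 0#
  Σl-absorbs xs f d unchanged = identityˡ-unique (Σl xs d) (Σl xs f) (trans (sym (Σl-+ xs d f)) unchanged)

  -- For the upper
  -- half use g ↦ g · U (E a), for the lower half g ↦ U (E a) · g; both change
  -- the entry (a, n + a) by the diagonal entry in question.
  module _ {n} {S : Mat (n ℕ.+ n) (n ℕ.+ n) → Set} (stable : ShearStable n S)
           (gs : List (Mat (n ℕ.+ n) (n ℕ.+ n))) (enumerates : Enumerates gs S) where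

    diagonal : Half → Fin n → Mat (n ℕ.+ n) (n ℕ.+ n) → Carrier
    diagonal h a g = g (embed h a) (embed h a)

    -- The entry (a, n + a) is the one the shears U (E a) change.
    offDiagonal : Fin n → Mat (n ℕ.+ n) (n ℕ.+ n) → Carrier
    offDiagonal a g = g (embed upper a) (embed lower a)

    offDiagonal-resp : ∀ a {X Y} → X ≈ Y → offDiagonal a X ≡ offDiagonal a Y
    offDiagonal-resp a X≈Y = X≈Y _ _

    upperDiagonal-vanishes : ∀ a → Σl gs (diagonal upper a) ≡ 0#
    upperDiagonal-vanishes a = Σl-absorbs gs (offDiagonal a) (diagonal upper a) (begin
      Σl gs (λ g → diagonal upper a g + offDiagonal a g)
        ≡⟨ Σl-cong gs (λ g _ → trans (⊗-U-entry g (E a) a a) (cong (_+ offDiagonal a g) (⊗-E (quadrant g upper upper) a))) ⟨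
      Σl gs (λ g → offDiagonal a (g ⊗ U (E a)))
        ≡⟨ Σl-reindex gs enumerates shear (offDiagonal a) (offDiagonal-resp a) ⟩
      Σl gs (offDiagonal a) ∎)
      where
      open ≡-Reasoning
      shear : SelfBijection S
      shear = right-multiplication (U (E a)) (U (neg (E a))) (U-inverseʳ (E a)) (U-inverseˡ (E a))
        (proj₁ ∘ stable (E-symmetric a)) (proj₁ ∘ stable (λ s t → cong -_ (E-symmetric a s t)))

    lowerDiagonal-vanishes : ∀ a → Σl gs (diagonal lower a) ≡ 0#
    lowerDiagonal-vanishes a = Σl-absorbs gs (offDiagonal a) (diagonal lower a) (begin
      Σl gs (λ g → diagonal lower a g + offDiagonal a g)
        ≡⟨ Σl-cong gs (λ g _ → trans (+-comm _ _) (cong (offDiagonal a g +_) (sym (E-⊗ (quadrant g lower lower) a)))) ⟩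
      Σl gs (λ g → offDiagonal a g + (E a ⊗ quadrant g lower lower) a a)
        ≡⟨ Σl-cong gs (λ g _ → U-⊗-entry g (E a) a a) ⟨
      Σl gs (λ g → offDiagonal a (U (E a) ⊗ g))
        ≡⟨ Σl-reindex gs enumerates shear (offDiagonal a) (offDiagonal-resp a) ⟩
      Σl gs (offDiagonal a) ∎)
      where
      open ≡-Reasoning
      shear : SelfBijection S
      shear = left-multiplication (U (E a)) (U (neg (E a))) (U-inverseʳ (E a)) (U-inverseˡ (E a))
        (proj₂ ∘ stable (E-symmetric a)) (proj₂ ∘ stable (λ s t → cong -_ (E-symmetric a s t)))

    trace-sum-vanishes : Σl gs tr ≡ 0#
    trace-sum-vanishes = begin
      Σl gs (λ g → ∑ (n ℕ.+ n) (λ i → g i i))              ≡⟨ Σl-∑ gs (n ℕ.+ n) (λ g i → g i i) ⟩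
      ∑ (n ℕ.+ n) (λ i → Σl gs (λ g → g i i))              ≡⟨ ∑-split n n _ ⟩
      ∑ n (λ a → Σl gs (diagonal upper a)) + ∑ n (λ a → Σl gs (diagonal lower a))
        ≡⟨ cong₂ _+_ (trans (∑-cong n upperDiagonal-vanishes) (∑-zero n))
                     (trans (∑-cong n lowerDiagonal-vanishes) (∑-zero n)) ⟩
      0# + 0#                                               ≡⟨ +-identityˡ 0# ⟩
      0#                                                    ∎
      where open ≡-Reasoning

  codeSum-complement : ∀ {m} (gs : List (Mat m m)) (u : Vec Bool (length gs)) →
    codeSum gs (complement u) + codeSum gs u ≡ Σl gs tr
  codeSum-complement []       []      = +-identityˡ 0#
  codeSum-complement (g ∷ gs) (b ∷ u) =
    trans (interchange _ _ _ _) (cong₂ _+_ (bit b) (codeSum-complement gs u))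
    where
    bit : ∀ b → (if not b then tr g else 0#) + (if b then tr g else 0#) ≡ tr g
    bit true  = +-identityˡ (tr g)
    bit false = +-identityʳ (tr g)

  inCode-complement : ∀ {m} (gs : List (Mat m m)) → Σl gs tr ≡ 0# →
    ∀ u → inCode gs (complement u) ≡ inCode gs u
  inCode-complement gs Σtr≡0 u = does-⇔ (mk⇔ x≡0⇒y≡0 y≡0⇒x≡0) (x ≟ 0#) (y ≟ 0#)
    where
    x y : Carrier
    x = codeSum gs (complement u)
    y = codeSum gs u
    x+y≡0 : x + y ≡ 0#
    x+y≡0 = trans (codeSum-complement gs u) Σtr≡0
    x≡0⇒y≡0 : x ≡ 0# → y ≡ 0#
    x≡0⇒y≡0 x≡0 = trans (sym (+-identityˡ y)) (trans (cong (_+ y) (sym x≡0)) x+y≡0)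
    y≡0⇒x≡0 : y ≡ 0# → x ≡ 0#
    y≡0⇒x≡0 y≡0 = trans (sym (+-identityʳ x)) (trans (cong (x +_) (sym y≡0)) x+y≡0)

  weightDist-symmetric : ∀ {m} (gs : List (Mat m m)) → Σl gs tr ≡ 0# →
    ∀ j → j ℕ.≤ length gs → Code.weightDist 𝔽 gs j ≡ Code.weightDist 𝔽 gs (length gs ℕ.∸ j)
  weightDist-symmetric gs Σtr≡0 = weight-symmetry (length gs) (inCode gs) (inCode-complement gs Σtr≡0)

  doubleCoset-weightDist-symmetric : ∀ n s (gs : List (Mat (n ℕ.+ n) (n ℕ.+ n))) → Enumerates gs (InDC n s) →
    ∀ j → j ℕ.≤ length gs → Code.weightDist 𝔽 gs j ≡ Code.weightDist 𝔽 gs (length gs ℕ.∸ j)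
  doubleCoset-weightDist-symmetric n s gs enumerates =
    weightDist-symmetric gs (trace-sum-vanishes (doubleCoset-shearStable n s) gs enumerates)

-- The remaining vocabulary of the statement, opened only now because inside
-- FieldMatrices _+_ denotes the addition of the field.
open import Data.Nat using (_≤_; _∸_; _^_; _+_)
open import Data.Nat.DivMod using (_%_)
open import Data.Sum using (_⊎_)

-- Both are double cosets P σ_s P, so the symmetry holds by the result above.
corollary17 : (𝔽 : FiniteField) (r : ℕ) → FiniteField.order 𝔽 ≡ 2 ^ r →
    (n : ℕ) (gs : List (Matrices.Mat 𝔽 (n + n) (n + n))) →
    ((n % 2 ≡ 1 × Matrices.Enumerates 𝔽 gs (Matrices.InDC 𝔽 n (n ∸ 1)))
      ⊎ (n % 2 ≡ 0 × 2 ≤ n × Matrices.Enumerates 𝔽 gs (Matrices.InDC 𝔽 n (n ∸ 2)))) →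
    (j : ℕ) → j ≤ length gs →
    Code.weightDist 𝔽 gs j ≡ Code.weightDist 𝔽 gs (length gs ∸ j)
corollary17 𝔽 _ _ n gs (inj₁ (_ , enumerates)) =
  FieldMatrices.doubleCoset-weightDist-symmetric 𝔽 n (n ∸ 1) gs enumerates
corollary17 𝔽 _ _ n gs (inj₂ (_ , _ , enumerates)) =
  FieldMatrices.doubleCoset-weightDist-symmetric 𝔽 n (n ∸ 2) gs enumerates
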